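{- Let $\lambda=(\lambda_1\ge\dots\ge\lambda_r\ge0)$ be a partition, $\rho=(r-1,r-2,\dots,0)$, $\Theta=(\Theta_1,\dots,\Theta_r)\in\{\Gamma,\Delta\}^r$ and $\Theta'=(\Theta_1,\dots,\Theta_{r-1})$. There is a bijection $\iota_\Theta:\mathfrak S^\Theta_{\lambda+\rho}\to\mathrm{GTP}^{\Theta'}_{\lambda+\rho}$.
   Context: Palette $\mathcal P=\{c_1<\dots<c_m\}$; fix $\kappa=(\kappa_1,\dots,\kappa_r)\in\mathcal P^r$ (top boundary colours) and an integer $N\ge\lambda_1+r$. Fused crystal vertices: left/right edges and top/bottom edges each carry $\varnothing$ or one colour. Configurations (left, top, right, bottom), row parameter $z$, unlisted weight $0$. Gamma: $(\varnothing,\varnothing,\varnothing,\varnothing)\mapsto1$; $(c_i,c_j,c_i,c_j)\mapsto0$ if $i<j$, $z$ if $i\ge j$; $(c_i,c_j,c_j,c_i)\mapsto z$ if $i<j$, $0$ if $i>j$; $(\varnothing,c_i,\varnothing,c_i)\mapsto0$; $(c_i,\varnothing,c_i,\varnothing)\mapsto z$; $(c_i,\varnothing,\varnothing,c_i)\mapsto z$; $(\varnothing,c_i,c_i,\varnothing)\mapsto1$. Delta: $(\varnothing,\varnothing,\varnothing,\varnothing)\mapsto z$; $(c_i,c_j,c_i,c_j)\mapsto1$ if $i\le j$, $0$ if $i>j$; $(c_j,c_j,c_i,c_i)\mapsto0$ if $i<j$, $1$ if $i>j$; $(\varnothing,c_i,\varnothing,c_i)\mapsto0$; $(c_i,\varnothing,c_i,\varnothing)\mapsto1$;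 $(\varnothing,\varnothing,c_i,c_i)\mapsto z$; $(c_i,c_i,\varnothing,\varnothing)\mapsto1$. Lattice: rows $1..r$ top to bottom, $N$ columns numbered $0..N-1$ right to left; vertices of row $t$ are of type $\Theta_t$ with parameter $z_t$. For $\sigma\in\mathcal P^r$, $\mathfrak S^\Theta_{\lambda+\rho,\sigma}$ is the set of edge labellings with every vertex weight nonzero such that: the top boundary edge of column $\lambda_t+r-t$ carries $\kappa_t$ ($t=1..r$) and all other top edges are empty; all bottom edges empty; if $\Theta_t=\Gamma$ the left boundary edge of row $t$ is empty and the right one carries $\sigma_t$; if $\Theta_t=\Delta$ the right one is empty and the left one carries $\sigma_t$. $\mathfrak S^\Theta_{\lambda+\rho}=\bigsqcup_\sigma\mathfrak S^\Theta_{\lambda+\rho,\sigma}$. Gelfand–Tsetlin patterns: arrays $(a_{i,j})_{0\le i\le j\le r-1}$ of nonnegative integers (row $i$ is $a_{i,i},\dots,a_{i,r-1}$) with $a_{i-1,j-1}\ge a_{i,j}\ge a_{i-1,j}$ for all $1\le i\le j\le r-1$. $\mathrm{GTP}_\nu$: those with top row $a_{0,j}=\nu_{j+1}$. The row pair $(i-1,i)$ is of type $\Gamma$ if $a_{i-1,j-1}>a_{i,j}\ge a_{i-1,j}$ for all $j$, of type $\Delta$ if $a_{i-1,j-1}\ge a_{i,j}>a_{i-1,j}$ for all $j$. For $\Theta'\in\{\Gamma,\Delta\}^{r-1}$, $\mathrm{GTP}^{\Theta'}_\nu\subseteq\mathrm{GTP}_\nu$ consists of the patterns whose row pair $(i-1,i)$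 has type $\Theta'_i$ for each $i=1,\dots,r-1$. -}

module Defs where

open import Data.Nat using (ℕ; zero; suc; _+_; _∸_; _≤_; _<_; _≡ᵇ_)
open import Data.Fin as Fin using (Fin; toℕ; inject₁)
open import Data.Maybe using (Maybe; just; nothing)
open import Data.Bool using (if_then_else_)
open import Data.Product using (Σ; _×_; _,_)
open import Data.Unit using (⊤)
open import Data.Vec using (Vec; []; _∷_; lookup; tabulate; map; head; last; replicate; allFin)
open import Data.Vec.Relation.Unary.All using (All)
open import Relation.Nullary using (does)
open import Relation.Binary.PropositionalEquality using (_≡_)

-- Palette P = {c_1 < ... < c_m} is modelled by Fin m (order via toℕ).
-- An edge carries either ∅ (nothing) or one colour (just c).

Edge : ℕ → Set
Edge m = Maybe (Fin m)

data RowType : Set where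
  Γ Δ : RowType

-- Weights of the fused vertices are 0, 1 or z; we only need to know
-- whether a weight is nonzero, so we record which of the three it is.
data W : Set where
  𝟎 𝟏 𝐳 : W

data NonZeroW : W → Set where
  nz-one : NonZeroW 𝟏
  nz-z   : NonZeroW 𝐳

-- Gamma weights, arguments in the order (left, top, right, bottom).
-- Unlisted configurations have weight 0.
weightΓ : ∀ {m} → Edge m → Edge m → Edge m → Edge m → W
weightΓ nothing nothing nothing nothing = 𝟏
weightΓ (just a) (just b) (just c) (just d) with does (a Fin.≟ c) | does (b Fin.≟ d) | does (a Fin.≟ d) | does (b Fin.≟ c)
... | Data.Bool.true | Data.Bool.true | _ | _ =
  if does (b Fin.≤? a) then 𝐳 else 𝟎
... | _ | _ | Data.Bool.true | Data.Bool.true =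
  if does (a Fin.<? b) then 𝐳 else 𝟎
... | _ | _ | _ | _ = 𝟎
weightΓ nothing (just b) nothing (just d) = 𝟎
weightΓ (just a) nothing (just c) nothing = if does (a Fin.≟ c) then 𝐳 else 𝟎
weightΓ (just a) nothing nothing (just d) = if does (a Fin.≟ d) then 𝐳 else 𝟎
weightΓ nothing (just b) (just c) nothing = if does (b Fin.≟ c) then 𝟏 else 𝟎
weightΓ _ _ _ _ = 𝟎

weightΔ : ∀ {m} → Edge m → Edge m → Edge m → Edge m → W
weightΔ nothing nothing nothing nothing = 𝐳
weightΔ (just a) (just b) (just c) (just d) with does (a Fin.≟ c) | does (b Fin.≟ d) | does (a Fin.≟ b) | does (c Fin.≟ d)
... | Data.Bool.true | Data.Bool.true | _ | _ =
  if does (a Fin.≤? b) then 𝟏 else 𝟎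
... | _ | _ | Data.Bool.true | Data.Bool.true =
  if does (a Fin.<? c) then 𝟏 else 𝟎
... | _ | _ | _ | _ = 𝟎
weightΔ nothing (just b) nothing (just d) = 𝟎
weightΔ (just a) nothing (just c) nothing = if does (a Fin.≟ c) then 𝟏 else 𝟎
weightΔ nothing nothing (just c) (just d) = if does (c Fin.≟ d) then 𝐳 else 𝟎
weightΔ (just a) (just b) nothing nothing = if does (a Fin.≟ b) then 𝟏 else 𝟎
weightΔ _ _ _ _ = 𝟎

weight : ∀ {m} → RowType → Edge m → Edge m → Edge m → Edge m → W
weight Γ = weightΓ
weight Δ = weightΔ

IsPartition : ∀ {r} → Vec ℕ r → Set
IsPartition {r} lam = ∀ (i j : Fin r) → i Fin.≤ j → lookup lam j ≤ lookup lam i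

-- λ_1 (taken to be 0 when r = 0)
λ₁ : ∀ {r} → Vec ℕ r → ℕ
λ₁ [] = 0
λ₁ (x ∷ _) = x

-- (λ+ρ)_t = λ_t + (r - t), t = 1..r  (0-based index i = t - 1)
lamRho : ∀ {r} → Vec ℕ r → Vec ℕ r
lamRho {r} lam = tabulate (λ i → lookup lam i + (r ∸ suc (toℕ i)))

-- Rows 0..r-1 (row t of the paper is index t-1), top to bottom;
-- columns 0..N-1, numbered right to left.
-- hor[i][e], e = 0..N : horizontal edges of row i; edge e is the right
--   edge of column e and the left edge of column e-1; e = 0 is the right
--   boundary edge and e = N the left boundary edge.
-- ver[k][s], s = 0..r : vertical edges of column k; s = 0 is the top
--   boundary edge, s = r the bottom boundary edge, and the vertex in row
--   i has top edge s = i and bottom edge s = i+1.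

record Config (m r N : ℕ) : Set where
  constructor config
  field
    hor : Vec (Vec (Edge m) (suc N)) r
    ver : Vec (Vec (Edge m) (suc r)) N
open Config public

vertexWeight : ∀ {m r N} → RowType → Config m r N → Fin r → Fin N → W
vertexWeight θ c i k =
  weight θ (lookup (lookup (hor c) i) (Fin.suc k))
           (lookup (lookup (ver c) k) (inject₁ i))
           (lookup (lookup (hor c) i) (inject₁ k))
           (lookup (lookup (ver c) k) (Fin.suc i))

topColour : ∀ {m n} → ℕ → Vec ℕ n → Vec (Fin m) n → Edge m
topColour k [] [] = nothing
topColour k (p ∷ ps) (c ∷ cs) = if k ≡ᵇ p then just c else topColour k ps cs

topBoundary : ∀ {m r} (N : ℕ) → Vec (Fin m) r → Vec ℕ r → Vec (Edge m) N
topBoundary N κ lam = tabulate (λ (k : Fin N) → topColour (toℕ k) (lamRho lam) κ)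

-- side boundary condition for one row: Γ : left ∅, right σ_t;
-- Δ : right ∅, left σ_t.
data SideBoundary {m N : ℕ} : RowType → Fin m → Vec (Edge m) (suc N) → Set where
  sideΓ : ∀ {s h} → last h ≡ nothing → head h ≡ just s → SideBoundary Γ s h
  sideΔ : ∀ {s h} → head h ≡ nothing → last h ≡ just s → SideBoundary Δ s h

record InS {m r : ℕ} (N : ℕ) (κ : Vec (Fin m) r) (lam : Vec ℕ r)
           (Θ : Vec RowType r) (σ : Vec (Fin m) r) (c : Config m r N) : Set where
  field
    nonzero : All (λ i → All (λ k → NonZeroW (vertexWeight (lookup Θ i) c i k)) (allFin N)) (allFin r)
    top     : map head (ver c) ≡ topBoundary N κ lam
    bottom  : map last (ver c) ≡ replicate N nothing
    sides   : All (λ i → SideBoundary (lookup Θ i) (lookup σ i) (lookup (hor c) i)) (allFin r)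

Sσ : ∀ {m r} (N : ℕ) → Vec (Fin m) r → Vec ℕ r → Vec RowType r → Vec (Fin m) r → Set
Sσ {m} {r} N κ lam Θ σ = Σ (Config m r N) (InS N κ lam Θ σ)

S : ∀ {m r} (N : ℕ) → Vec (Fin m) r → Vec ℕ r → Vec RowType r → Set
S {m} {r} N κ lam Θ = Σ (Vec (Fin m) r) (Sσ N κ lam Θ)

-- Gelfand–Tsetlin patterns.
-- Tri r : triangular arrays; the first component is row 0 (length r),
-- followed by row 1 (length r-1), etc.

Tri : ℕ → Set
Tri zero = ⊤
Tri (suc n) = Vec ℕ (suc n) × Tri n

data Interlace : ∀ {n} → Vec ℕ (suc n) → Vec ℕ n → Set where
  []  : ∀ {a} → Interlace (a ∷ []) []
  _∷_ : ∀ {n a b x} {us : Vec ℕ n} {ls : Vec ℕ n} →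
        (x ≤ a × b ≤ x) → Interlace (b ∷ us) ls → Interlace (a ∷ b ∷ us) (x ∷ ls)

PairCond : RowType → ℕ → ℕ → ℕ → Set
PairCond Γ a x b = x < a × b ≤ x
PairCond Δ a x b = x ≤ a × b < x

data PairType (θ : RowType) : ∀ {n} → Vec ℕ (suc n) → Vec ℕ n → Set where
  []  : ∀ {a} → PairType θ (a ∷ []) []
  _∷_ : ∀ {n a b x} {us : Vec ℕ n} {ls : Vec ℕ n} →
        PairCond θ a x b → PairType θ (b ∷ us) ls → PairType θ (a ∷ b ∷ us) (x ∷ ls)

IsGTP : ∀ {r} → Tri r → Set
IsGTP {zero} _ = ⊤
IsGTP {suc zero} _ = ⊤
IsGTP {suc (suc n)} (u , l , rest) = Interlace u l × IsGTP {suc n} (l , rest)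

TopRow : ∀ {r} → Tri r → Vec ℕ r → Set
TopRow {zero} _ _ = ⊤
TopRow {suc n} (u , _) ν = u ≡ ν

-- row pair (i-1,i) has type Θ_i for i = 1..r-1 (Θ_r is not used, i.e. Θ' is used)
HasTypes : ∀ {r} → Vec RowType r → Tri r → Set
HasTypes {zero} _ _ = ⊤
HasTypes {suc zero} _ _ = ⊤
HasTypes {suc (suc n)} (θ ∷ Θ) (u , l , rest) = PairType θ u l × HasTypes {suc n} Θ (l , rest)

GTPΘ : ∀ {r} → Vec RowType r → Vec ℕ r → Set
GTPΘ {r} Θ ν = Σ (Tri r) (λ T → (TopRow T ν × IsGTP T) × HasTypes Θ T)

-- Every admissible vertex conserves paths, and along a row the colours are forced: once we
-- know which bottom edges of a row are occupied, the edges leaving each vertex are determined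
-- by the edges entering it (Γ-rows are filled in from their empty left boundary, Δ-rows from
-- their empty right boundary). A configuration is therefore determined by the occupied columns
-- on its r + 1 levels of vertical edges, i.e. by decreasing sequences of positions, the top one
-- being λ + ρ and the bottom one empty. Reading the occupancy of a row as a finite automaton
-- shows that two consecutive levels are compatible exactly when their position sequences
-- interlace strictly as prescribed by the row type, which is the row-pair condition of a
-- Gelfand–Tsetlin pattern.

module Submission where

open import Defs
open import Axiom.UniquenessOfIdentityProofs.WithK using (uip)
open import Data.Bool using (Bool; true; false; if_then_else_)
open import Data.Empty using (⊥-elim)
open import Data.Fin as Fin using (Fin; zero; suc; toℕ; inject₁; opposite; fromℕ)
open import Data.Fin.Properties as Fin using (opposite-involutive; opposite-prop)
open import Data.List as List using (List; []; _∷_)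
open import Data.List.Relation.Unary.All as All using (All; []; _∷_)
open import Data.List.Relation.Unary.Linked as Linked using (Linked; []; [-]; _∷_)
open import Data.List.Relation.Unary.Linked.Properties using (Linked⇒All)
open import Data.Maybe using (Maybe; just; nothing; is-just; _>>=_)
open import Data.Maybe.Properties using (just-injective)
open import Data.Nat using (ℕ; zero; suc; _+_; _∸_; _<_; _≤_; _>_; _≡ᵇ_; z≤n; s≤s)
open import Data.Nat.Properties as ℕ
  using ( n<1+n; n≤1+n; m<n⇒m<1+n; m≤n⇒m≤1+n; m<1+n⇒m<n∨m≡n; <⇒≤; ≤-refl; ≤-trans; <-trans
        ; <-≤-trans; ≤-<-trans; <-irrefl; <-asym; <⇒≱; ≰⇒>; <⇒≢; >⇒≢; suc-injective
        ; +-monoˡ-≤; +-monoʳ-< )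
open import Data.Product using (Σ; Σ-syntax; _×_; _,_; proj₁; proj₂)
import Data.Product.Function.Dependent.Propositional as Σ
open import Data.Product.Function.NonDependent.Propositional using (_×-↔_)
open import Data.Sum using (inj₁; inj₂)
open import Data.Unit using (⊤)
open import Data.Vec using (Vec; []; _∷_; head; last; tail; map; lookup; tabulate; replicate; toList)
open import Data.Vec.Properties
  using (lookup∘tabulate; tabulate∘lookup; tabulate-cong; lookup-map; lookup-replicate; length-toList)
import Data.Vec.Relation.Unary.All as VecAll
open import Data.Vec.Relation.Unary.All.Properties using (tabulate⁺; tabulate⁻)
open import Function using (_∘_; flip)
open import Function.Bundles using (_↔_; _⇔_; _⤖_; mk↔ₛ′; mk⇔; Equivalence)
open import Function.Properties.Equivalence using () renaming (trans to ⇔-trans)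
open import Function.Properties.Inverse using (↔-refl; ↔-sym; ↔-trans; ↔⇒⤖)
open import Function.Related.Propositional using (module EquationalReasoning)
open import Function.Related.TypeIsomorphisms using (Σ-assoc)
open import Relation.Binary.PropositionalEquality
open import Relation.Nullary using (Dec; yes; no; does; ¬_)
open import Relation.Nullary.Decidable using (dec-true; dec-false)
open import Relation.Nullary.Irrelevant using (Irrelevant)

private variable
  A B : Set
  m n r N : ℕ

×-irrelevant : Irrelevant A → Irrelevant B → Irrelevant (A × B)
×-irrelevant irrA irrB (a , b) (a′ , b′) = cong₂ _,_ (irrA a a′) (irrB b b′)

Σ-≡-irrelevant : {P : A → Set} → (∀ a → Irrelevant (P a)) →
  {x y : Σ A P} → proj₁ x ≡ proj₁ y → x ≡ y
Σ-≡-irrelevant irr {a , p} {.a , q} refl = cong (a ,_) (irr a p q)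

⇔⇒↔ : Irrelevant A → Irrelevant B → A ⇔ B → A ↔ B
⇔⇒↔ irrA irrB A⇔B = mk↔ₛ′ to from (λ b → irrB _ b) (λ a → irrA _ a)
  where open Equivalence A⇔B

both-empty : ¬ A → ¬ B → A ⇔ B
both-empty ¬a ¬b = mk⇔ (λ a → ⊥-elim (¬a a)) (λ b → ⊥-elim (¬b b))

subset-↔ : {P : A → Set} {Q : B → Set} → (∀ a → Irrelevant (P a)) → (∀ b → Irrelevant (Q b)) →
  (f : A → B) (g : B → A) → (∀ {a} → P a → Q (f a)) → (∀ {b} → Q b → P (g b)) →
  (∀ {a} → P a → g (f a) ≡ a) → (∀ {b} → Q b → f (g b) ≡ b) → Σ A P ↔ Σ B Q
subset-↔ irrP irrQ f g P⇒Q Q⇒P gf fg = mk↔ₛ′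
  (λ (a , p) → f a , P⇒Q p) (λ (b , q) → g b , Q⇒P q)
  (λ (_ , q) → Σ-≡-irrelevant irrQ (fg q)) (λ (_ , p) → Σ-≡-irrelevant irrP (gf p))

Σ-×-reindex : {P : A → Set} {Q : B → Set} (X : A → Set) →
  (∀ a → Irrelevant (P a)) → (∀ b → Irrelevant (Q b)) →
  (f : A → B) (g : B → A) → (∀ {a} → P a → Q (f a)) → (∀ {b} → Q b → P (g b)) →
  (∀ {a} → P a → g (f a) ≡ a) → (∀ {b} → Q b → f (g b) ≡ b) →
  (Σ[ a ∈ A ] (P a × X a)) ↔ (Σ[ b ∈ B ] (Q b × X (g b)))
Σ-×-reindex X irrP irrQ f g P⇒Q Q⇒P gf fg =
  ↔-trans (↔-sym Σ-assoc) (↔-trans (↔-sym (Σ.cong (↔-sym φ) ↔-refl)) Σ-assoc)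
  where φ = subset-↔ irrP irrQ f g P⇒Q Q⇒P gf fg

Σ-×-congʳ : {P X Y : A → Set} → (∀ {a} → P a → X a ↔ Y a) →
  (Σ[ a ∈ A ] (P a × X a)) ↔ (Σ[ a ∈ A ] (P a × Y a))
Σ-×-congʳ X↔Y = ↔-trans (↔-sym Σ-assoc) (↔-trans (Σ.congˡ (λ {(_ , p)} → X↔Y p)) Σ-assoc)

lookup-extensionality : ∀ {u v : Vec A n} → (∀ i → lookup u i ≡ lookup v i) → u ≡ v
lookup-extensionality {u = u} {v} eq = trans (sym (tabulate∘lookup u)) (trans (tabulate-cong eq) (tabulate∘lookup v))

-- Vector reversal, in the form whose entries are easiest to compute with.
mirror : Vec A n → Vec A n
mirror v = tabulate (lookup v ∘ opposite)

lookup-mirror : ∀ (v : Vec A n) i → lookup (mirror v) i ≡ lookup v (opposite i)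
lookup-mirror v = lookup∘tabulate (lookup v ∘ opposite)

mirror-involutive : ∀ (v : Vec A n) → mirror (mirror v) ≡ v
mirror-involutive v = lookup-extensionality λ i →
  trans (lookup-mirror (mirror v) i) (trans (lookup-mirror v _) (cong (lookup v) (opposite-involutive i)))

map-mirror-involutive : ∀ (vs : Vec (Vec A n) N) → map mirror (map mirror vs) ≡ vs
map-mirror-involutive []       = refl
map-mirror-involutive (v ∷ vs) = cong₂ _∷_ (mirror-involutive v) (map-mirror-involutive vs)

mirror-replicate : ∀ n (x : A) → mirror (replicate n x) ≡ replicate n x
mirror-replicate n x = lookup-extensionality λ i →
  trans (lookup-mirror (replicate n x) i) (trans (lookup-replicate (opposite i) x) (sym (lookup-replicate i x)))

last-lookup : ∀ (v : Vec A (suc n)) → last v ≡ lookup v (fromℕ n)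
last-lookup (_ ∷ [])     = refl
last-lookup (_ ∷ y ∷ ys) = last-lookup (y ∷ ys)

head-lookup : ∀ (v : Vec A (suc n)) → head v ≡ lookup v zero
head-lookup (_ ∷ _) = refl

head-mirror : ∀ (v : Vec A (suc n)) → head (mirror v) ≡ last v
head-mirror v = sym (last-lookup v)

last-mirror : ∀ (v : Vec A (suc n)) → last (mirror v) ≡ head v
last-mirror {n = n} v = trans (last-lookup (mirror v))
  (trans (lookup-mirror v (fromℕ n)) (trans (cong (lookup v) (opposite-involutive zero)) (sym (head-lookup v))))

-- Column k (numbered right to left) of a lattice, from its levels read left to right.
columns : Vec (Vec A N) (suc r) → Vec (Vec A (suc r)) N
columns Ls = tabulate λ k → tabulate λ s → lookup (lookup Ls s) (opposite k)

levels : Vec (Vec A (suc r)) N → Vec (Vec A N) (suc r)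
levels cs = tabulate λ s → tabulate λ j → lookup (lookup cs (opposite j)) s

lookup²-tabulate : ∀ (f : Fin n → Fin N → A) i j → lookup (lookup (tabulate λ i → tabulate (f i)) i) j ≡ f i j
lookup²-tabulate f i j = trans (cong (λ v → lookup v j) (lookup∘tabulate _ i)) (lookup∘tabulate (f i) j)

columns-levels : ∀ (cs : Vec (Vec A (suc r)) N) → columns (levels cs) ≡ cs
columns-levels cs = lookup-extensionality λ k → lookup-extensionality λ s →
  trans (lookup²-tabulate (λ k s → lookup (lookup (levels cs) s) (opposite k)) k s)
    (trans (lookup²-tabulate (λ s j → lookup (lookup cs (opposite j)) s) s (opposite k))
      (cong (λ k′ → lookup (lookup cs k′) s) (opposite-involutive k)))

levels-columns : ∀ (Ls : Vec (Vec A N) (suc r)) → levels (columns Ls) ≡ Ls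
levels-columns Ls = lookup-extensionality λ s → lookup-extensionality λ j →
  trans (lookup²-tabulate (λ s j → lookup (lookup (columns Ls) (opposite j)) s) s j)
    (trans (lookup²-tabulate (λ k s → lookup (lookup Ls s) (opposite k)) (opposite j) s)
      (cong (lookup (lookup Ls s)) (opposite-involutive j)))

head-levels : ∀ (cs : Vec (Vec A (suc r)) N) → head (levels cs) ≡ mirror (map head cs)
head-levels cs = lookup-extensionality λ j →
  trans (lookup∘tabulate (λ j → lookup (lookup cs (opposite j)) zero) j)
    (trans (sym (head-lookup (lookup cs (opposite j))))
      (trans (sym (lookup-map (opposite j) head cs)) (sym (lookup-mirror (map head cs) j))))

map-head-columns : ∀ (Ls : Vec (Vec A N) (suc r)) → map head (columns Ls) ≡ mirror (head Ls)
map-head-columns Ls = lookup-extensionality λ k →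
  trans (lookup-map k head (columns Ls))
    (trans (head-lookup (lookup (columns Ls) k))
      (trans (lookup²-tabulate (λ k s → lookup (lookup Ls s) (opposite k)) k zero)
        (trans (cong (λ L → lookup L (opposite k)) (sym (head-lookup Ls))) (sym (lookup-mirror (head Ls) k)))))

map-last-columns : ∀ (Ls : Vec (Vec A N) (suc r)) → map last (columns Ls) ≡ mirror (last Ls)
map-last-columns {r = r} Ls = lookup-extensionality λ k →
  trans (lookup-map k last (columns Ls))
    (trans (last-lookup (lookup (columns Ls) k))
      (trans (lookup²-tabulate (λ k s → lookup (lookup Ls s) (opposite k)) k (fromℕ r))
        (trans (cong (λ L → lookup L (opposite k)) (sym (last-lookup Ls))) (sym (lookup-mirror (last Ls) k)))))

-- Admissible vertices

nonzero-if⁺ : ∀ {P : Set} (d : Dec P) {w} → P → NonZeroW w → NonZeroW (if does d then w else 𝟎)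
nonzero-if⁺ (yes _) _ nz = nz
nonzero-if⁺ (no ¬p) p _ = ⊥-elim (¬p p)

nonzero-if⁻ : ∀ {P : Set} (d : Dec P) {w} → NonZeroW (if does d then w else 𝟎) → P
nonzero-if⁻ (yes p) _ = p

-- Edges are listed as (left, top, right, bottom); a Γ-vertex is entered from the left and the top.
data AdmissibleΓ {m : ℕ} : Edge m → Edge m → Edge m → Edge m → Set where
  empty      : AdmissibleΓ nothing nothing nothing nothing
  cross      : ∀ {a b} → b Fin.≤ a → AdmissibleΓ (just a) (just b) (just a) (just b)
  swap       : ∀ {a b} → a Fin.< b → AdmissibleΓ (just a) (just b) (just b) (just a)
  horizontal : ∀ {a} → AdmissibleΓ (just a) nothing (just a) nothing
  turnDown   : ∀ {a} → AdmissibleΓ (just a) nothing nothing (just a)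
  turnRight  : ∀ {a} → AdmissibleΓ nothing (just a) (just a) nothing

-- A Δ-vertex is entered from the right and the top.
data AdmissibleΔ {m : ℕ} : Edge m → Edge m → Edge m → Edge m → Set where
  empty      : AdmissibleΔ nothing nothing nothing nothing
  cross      : ∀ {a b} → a Fin.≤ b → AdmissibleΔ (just a) (just b) (just a) (just b)
  swap       : ∀ {a c} → a Fin.< c → AdmissibleΔ (just a) (just a) (just c) (just c)
  horizontal : ∀ {a} → AdmissibleΔ (just a) nothing (just a) nothing
  turnDown   : ∀ {a} → AdmissibleΔ nothing nothing (just a) (just a)
  turnLeft   : ∀ {a} → AdmissibleΔ (just a) (just a) nothing nothing

nonzero⇒admissibleΓ : ∀ (l t r b : Edge m) → NonZeroW (weightΓ l t r b) → AdmissibleΓ l t r b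
nonzero⇒admissibleΓ nothing nothing nothing nothing _ = empty
nonzero⇒admissibleΓ nothing (just b) (just c) nothing nz
  with refl ← nonzero-if⁻ (b Fin.≟ c) nz = turnRight
nonzero⇒admissibleΓ (just a) nothing (just c) nothing nz
  with refl ← nonzero-if⁻ (a Fin.≟ c) nz = horizontal
nonzero⇒admissibleΓ (just a) nothing nothing (just d) nz
  with refl ← nonzero-if⁻ (a Fin.≟ d) nz = turnDown
nonzero⇒admissibleΓ (just a) (just b) (just c) (just d) nz
  with a Fin.≟ c | b Fin.≟ d | a Fin.≟ d | b Fin.≟ c
... | yes refl | yes refl | _        | _        = cross (nonzero-if⁻ (b Fin.≤? a) nz)
... | yes refl | no b≢d   | yes refl | yes refl = ⊥-elim (b≢d refl)
... | no _     | _        | yes refl | yes refl = swap (nonzero-if⁻ (a Fin.<? b) nz)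
nonzero⇒admissibleΓ (just _) (just _) (just _) (just _) () | yes _ | no _ | yes _ | no _
nonzero⇒admissibleΓ (just _) (just _) (just _) (just _) () | yes _ | no _ | no _  | _
nonzero⇒admissibleΓ (just _) (just _) (just _) (just _) () | no _  | _    | yes _ | no _
nonzero⇒admissibleΓ (just _) (just _) (just _) (just _) () | no _  | _    | no _  | _
nonzero⇒admissibleΓ nothing nothing nothing (just _) ()
nonzero⇒admissibleΓ nothing nothing (just _) _ ()
nonzero⇒admissibleΓ nothing (just _) nothing nothing ()
nonzero⇒admissibleΓ nothing (just _) nothing (just _) ()
nonzero⇒admissibleΓ nothing (just _) (just _) (just _) ()
nonzero⇒admissibleΓ (just _) nothing nothing nothing ()
nonzero⇒admissibleΓ (just _) nothing (just _) (just _) ()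
nonzero⇒admissibleΓ (just _) (just _) nothing _ ()
nonzero⇒admissibleΓ (just _) (just _) (just _) nothing ()

nonzero⇒admissibleΔ : ∀ (l t r b : Edge m) → NonZeroW (weightΔ l t r b) → AdmissibleΔ l t r b
nonzero⇒admissibleΔ nothing nothing nothing nothing _ = empty
nonzero⇒admissibleΔ nothing nothing (just c) (just d) nz
  with refl ← nonzero-if⁻ (c Fin.≟ d) nz = turnDown
nonzero⇒admissibleΔ (just a) nothing (just c) nothing nz
  with refl ← nonzero-if⁻ (a Fin.≟ c) nz = horizontal
nonzero⇒admissibleΔ (just a) (just b) nothing nothing nz
  with refl ← nonzero-if⁻ (a Fin.≟ b) nz = turnLeft
nonzero⇒admissibleΔ (just a) (just b) (just c) (just d) nz
  with a Fin.≟ c | b Fin.≟ d | a Fin.≟ b | c Fin.≟ d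
... | yes refl | yes refl | _        | _        = cross (nonzero-if⁻ (a Fin.≤? b) nz)
... | yes refl | no b≢d   | yes refl | yes refl = ⊥-elim (b≢d refl)
... | no _     | _        | yes refl | yes refl = swap (nonzero-if⁻ (a Fin.<? c) nz)
nonzero⇒admissibleΔ (just _) (just _) (just _) (just _) () | yes _ | no _ | yes _ | no _
nonzero⇒admissibleΔ (just _) (just _) (just _) (just _) () | yes _ | no _ | no _  | _
nonzero⇒admissibleΔ (just _) (just _) (just _) (just _) () | no _  | _    | yes _ | no _
nonzero⇒admissibleΔ (just _) (just _) (just _) (just _) () | no _  | _    | no _  | _
nonzero⇒admissibleΔ nothing nothing nothing (just _) ()
nonzero⇒admissibleΔ nothing nothing (just _) nothing ()
nonzero⇒admissibleΔ nothing (just _) nothing nothing ()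
nonzero⇒admissibleΔ nothing (just _) nothing (just _) ()
nonzero⇒admissibleΔ nothing (just _) (just _) _ ()
nonzero⇒admissibleΔ (just _) nothing nothing _ ()
nonzero⇒admissibleΔ (just _) nothing (just _) (just _) ()
nonzero⇒admissibleΔ (just _) (just _) nothing (just _) ()
nonzero⇒admissibleΔ (just _) (just _) (just _) nothing ()

admissible⇒nonzeroΓ : ∀ {l t r b : Edge m} → AdmissibleΓ l t r b → NonZeroW (weightΓ l t r b)
admissible⇒nonzeroΓ empty = nz-one
admissible⇒nonzeroΓ (cross {a} {b} b≤a) with a Fin.≟ a | b Fin.≟ b
... | yes _  | yes _  = nonzero-if⁺ (b Fin.≤? a) b≤a nz-z
... | no a≢a | _      = ⊥-elim (a≢a refl)
... | yes _  | no b≢b = ⊥-elim (b≢b refl)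
admissible⇒nonzeroΓ (swap {a} {b} a<b) with a Fin.≟ b | b Fin.≟ a | a Fin.≟ a | b Fin.≟ b
... | yes refl | _        | _      | _      = ⊥-elim (Fin.<-irrefl refl a<b)
... | no _     | yes refl | _      | _      = ⊥-elim (Fin.<-irrefl refl a<b)
... | no _     | no _     | yes _  | yes _  = nonzero-if⁺ (a Fin.<? b) a<b nz-z
... | no _     | no _     | no a≢a | _      = ⊥-elim (a≢a refl)
... | no _     | no _     | yes _  | no b≢b = ⊥-elim (b≢b refl)
admissible⇒nonzeroΓ (horizontal {a}) = nonzero-if⁺ (a Fin.≟ a) refl nz-z
admissible⇒nonzeroΓ (turnDown {a})   = nonzero-if⁺ (a Fin.≟ a) refl nz-z
admissible⇒nonzeroΓ (turnRight {a})  = nonzero-if⁺ (a Fin.≟ a) refl nz-one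

admissible⇒nonzeroΔ : ∀ {l t r b : Edge m} → AdmissibleΔ l t r b → NonZeroW (weightΔ l t r b)
admissible⇒nonzeroΔ empty = nz-z
admissible⇒nonzeroΔ (cross {a} {b} a≤b) with a Fin.≟ a | b Fin.≟ b
... | yes _  | yes _  = nonzero-if⁺ (a Fin.≤? b) a≤b nz-one
... | no a≢a | _      = ⊥-elim (a≢a refl)
... | yes _  | no b≢b = ⊥-elim (b≢b refl)
admissible⇒nonzeroΔ (swap {a} {c} a<c) with a Fin.≟ c | a Fin.≟ a | c Fin.≟ c
... | yes refl | _      | _      = ⊥-elim (Fin.<-irrefl refl a<c)
... | no _     | yes _  | yes _  = nonzero-if⁺ (a Fin.<? c) a<c nz-one
... | no _     | no a≢a | _      = ⊥-elim (a≢a refl)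
... | no _     | yes _  | no c≢c = ⊥-elim (c≢c refl)
admissible⇒nonzeroΔ (horizontal {a}) = nonzero-if⁺ (a Fin.≟ a) refl nz-one
admissible⇒nonzeroΔ (turnDown {a})   = nonzero-if⁺ (a Fin.≟ a) refl nz-z
admissible⇒nonzeroΔ (turnLeft {a})   = nonzero-if⁺ (a Fin.≟ a) refl nz-one

nonzero-irrelevant : ∀ {w} → Irrelevant (NonZeroW w)
nonzero-irrelevant nz-one nz-one = refl
nonzero-irrelevant nz-z   nz-z   = refl

crossOrSwap : ∀ {P : Set} → Dec P → Fin m → Fin m → Edge m × Edge m
crossOrSwap (yes _) a b = just a , just b
crossOrSwap (no _)  a b = just b , just a

-- Given the left and top edge of a Γ-vertex and whether its bottom edge is occupied,
-- the right and bottom edge are forced.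
exitΓ : Edge m → Edge m → Bool → Edge m × Edge m
exitΓ nothing  nothing  _     = nothing , nothing
exitΓ nothing  (just b) _     = just b , nothing
exitΓ (just a) nothing  false = just a , nothing
exitΓ (just a) nothing  true  = nothing , just a
exitΓ (just a) (just b) _     = crossOrSwap (b Fin.≤? a) a b

-- Dually, the right and top edge of a Δ-vertex force its left and bottom edge.
exitΔ : Edge m → Edge m → Bool → Edge m × Edge m
exitΔ nothing  nothing  _     = nothing , nothing
exitΔ nothing  (just b) _     = just b , nothing
exitΔ (just a) nothing  false = just a , nothing
exitΔ (just a) nothing  true  = nothing , just a
exitΔ (just a) (just b) _     = crossOrSwap (a Fin.≤? b) a b

-- Occupancy of the right edge from occupancy of the left, top and bottom edges.
stepΓ stepΔ : Bool → Bool → Bool → Maybe Bool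
stepΓ false false false = just false
stepΓ false true  false = just true
stepΓ true  false false = just true
stepΓ true  false true  = just false
stepΓ true  true  true  = just true
stepΓ _     _     _     = nothing

stepΔ false false false = just false
stepΔ false false true  = just true
stepΔ true  false false = just true
stepΔ true  true  false = just false
stepΔ true  true  true  = just true
stepΔ _     _     _     = nothing

admissibleΓ⇒exit : ∀ {l t r b : Edge m} → AdmissibleΓ l t r b →
  exitΓ l t (is-just b) ≡ (r , b) × stepΓ (is-just l) (is-just t) (is-just b) ≡ just (is-just r)
admissibleΓ⇒exit empty      = refl , refl
admissibleΓ⇒exit horizontal = refl , refl
admissibleΓ⇒exit turnDown   = refl , refl
admissibleΓ⇒exit turnRight  = refl , refl
admissibleΓ⇒exit (cross {a} {b} b≤a) with b Fin.≤? a
... | yes _   = refl , refl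
... | no b≰a  = ⊥-elim (b≰a b≤a)
admissibleΓ⇒exit (swap {a} {b} a<b) with b Fin.≤? a
... | yes b≤a = ⊥-elim (<⇒≱ a<b b≤a)
... | no _    = refl , refl

exit⇒admissibleΓ : ∀ (l t : Edge m) q {s} → stepΓ (is-just l) (is-just t) q ≡ just s →
  AdmissibleΓ l t (proj₁ (exitΓ l t q)) (proj₂ (exitΓ l t q)) ×
  is-just (proj₂ (exitΓ l t q)) ≡ q × is-just (proj₁ (exitΓ l t q)) ≡ s
exit⇒admissibleΓ nothing  nothing  false refl = empty , refl , refl
exit⇒admissibleΓ nothing  (just _) false refl = turnRight , refl , refl
exit⇒admissibleΓ (just _) nothing  false refl = horizontal , refl , refl
exit⇒admissibleΓ (just _) nothing  true  refl = turnDown , refl , refl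
exit⇒admissibleΓ (just a) (just b) true  refl with b Fin.≤? a
... | yes b≤a = cross b≤a , refl , refl
... | no b≰a  = swap (≰⇒> b≰a) , refl , refl

admissibleΔ⇒exit : ∀ {l t r b : Edge m} → AdmissibleΔ l t r b →
  exitΔ r t (is-just b) ≡ (l , b) × stepΔ (is-just l) (is-just t) (is-just b) ≡ just (is-just r)
admissibleΔ⇒exit empty      = refl , refl
admissibleΔ⇒exit horizontal = refl , refl
admissibleΔ⇒exit turnDown   = refl , refl
admissibleΔ⇒exit turnLeft   = refl , refl
admissibleΔ⇒exit (cross {a} {b} a≤b) with a Fin.≤? b
... | yes _   = refl , refl
... | no a≰b  = ⊥-elim (a≰b a≤b)
admissibleΔ⇒exit (swap {a} {c} a<c) with c Fin.≤? a
... | yes c≤a = ⊥-elim (<⇒≱ a<c c≤a)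
... | no _    = refl , refl

exit⇒admissibleΔ : ∀ (r t : Edge m) q {s} → stepΔ s (is-just t) q ≡ just (is-just r) →
  s ≡ is-just (proj₁ (exitΔ r t q)) ×
  AdmissibleΔ (proj₁ (exitΔ r t q)) t r (proj₂ (exitΔ r t q)) × is-just (proj₂ (exitΔ r t q)) ≡ q
exit⇒admissibleΔ nothing  nothing  false {false} refl = refl , empty , refl
exit⇒admissibleΔ nothing  (just _) false {true}  refl = refl , turnLeft , refl
exit⇒admissibleΔ (just _) nothing  false {true}  refl = refl , horizontal , refl
exit⇒admissibleΔ (just _) nothing  true  {false} refl = refl , turnDown , refl
exit⇒admissibleΔ nothing  nothing  false {true}  ()
exit⇒admissibleΔ nothing  nothing  true  {false} ()
exit⇒admissibleΔ nothing  nothing  true  {true}  ()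
exit⇒admissibleΔ nothing  (just _) false {false} ()
exit⇒admissibleΔ nothing  (just _) true  {false} ()
exit⇒admissibleΔ nothing  (just _) true  {true}  ()
exit⇒admissibleΔ (just _) nothing  false {false} ()
exit⇒admissibleΔ (just _) nothing  true  {true}  ()
exit⇒admissibleΔ (just _) (just _) false {false} ()
exit⇒admissibleΔ (just _) (just _) false {true}  ()
exit⇒admissibleΔ (just _) (just _) true  {false} ()
exit⇒admissibleΔ (just a) (just b) true  {true}  refl with a Fin.≤? b
... | yes a≤b = refl , cross a≤b , refl
... | no a≰b  = refl , swap (≰⇒> a≰b) , refl

-- Rows

-- Rows are read from left to right: a row of N vertices is given by its N+1 horizontal
-- edges (left boundary first) and its N top and N bottom edges.
AdmissibleRow : RowType → Vec (Edge m) (suc N) → Vec (Edge m) N → Vec (Edge m) N → Set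
AdmissibleRow θ (_ ∷ _) [] [] = ⊤
AdmissibleRow θ (l ∷ H) (t ∷ L) (b ∷ B) = NonZeroW (weight θ l t (head H) b) × AdmissibleRow θ H L B

AdmissibleRow-irrelevant : ∀ θ (H : Vec (Edge m) (suc N)) L B → Irrelevant (AdmissibleRow θ H L B)
AdmissibleRow-irrelevant θ (_ ∷ _) [] [] _ _ = refl
AdmissibleRow-irrelevant θ (_ ∷ H) (_ ∷ L) (_ ∷ B) =
  ×-irrelevant nonzero-irrelevant (AdmissibleRow-irrelevant θ H L B)

occupancy : Vec (Edge m) N → Vec Bool N
occupancy = map is-just

run : (Bool → Bool → Bool → Maybe Bool) → Bool → Vec Bool N → Vec Bool N → Maybe Bool
run step s []      []      = just s
run step s (p ∷ P) (q ∷ Q) = step s p q >>= λ s′ → run step s′ P Q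

-- The horizontal edges to the right of the left edge h, and the bottom edges.
rowΓ : Edge m → Vec (Edge m) N → Vec Bool N → Vec (Edge m) N × Vec (Edge m) N
rowΓ h []      []      = [] , []
rowΓ h (t ∷ L) (q ∷ Q) = h′ ∷ proj₁ rest , proj₂ (exitΓ h t q) ∷ proj₂ rest
  where h′   = proj₁ (exitΓ h t q)
        rest = rowΓ h′ L Q

rowΔ : Vec (Edge m) N → Vec Bool N → Vec (Edge m) (suc N) × Vec (Edge m) N
rowΔ []      []      = nothing ∷ [] , []
rowΔ (t ∷ L) (q ∷ Q) = proj₁ out ∷ proj₁ rest , proj₂ out ∷ proj₂ rest
  where rest = rowΔ L Q
        out  = exitΔ (head (proj₁ rest)) t q

rowΓ-sound : ∀ h (H : Vec (Edge m) N) L B → AdmissibleRow Γ (h ∷ H) L B →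
  rowΓ h L (occupancy B) ≡ (H , B) ×
  run stepΓ (is-just h) (occupancy L) (occupancy B) ≡ just (is-just (last (h ∷ H)))
rowΓ-sound h [] [] [] _ = refl , refl
rowΓ-sound l (r ∷ H) (t ∷ L) (b ∷ B) (nz , ok)
  with admissibleΓ⇒exit (nonzero⇒admissibleΓ l t r b nz) | rowΓ-sound r H L B ok
... | exit≡ , step≡ | row≡ , run≡ rewrite exit≡ | step≡ | row≡ = refl , run≡

rowΓ-complete : ∀ h (L : Vec (Edge m) N) Q {s} → run stepΓ (is-just h) (occupancy L) Q ≡ just s →
  AdmissibleRow Γ (h ∷ proj₁ (rowΓ h L Q)) L (proj₂ (rowΓ h L Q)) ×
  occupancy (proj₂ (rowΓ h L Q)) ≡ Q × is-just (last (h ∷ proj₁ (rowΓ h L Q))) ≡ s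
rowΓ-complete h [] [] refl = _ , refl , refl
rowΓ-complete h (t ∷ L) (q ∷ Q) accepts with stepΓ (is-just h) (is-just t) q in step≡
... | just s′ with exit⇒admissibleΓ h t q step≡
...   | adm , b≡ , r≡ rewrite sym r≡ with rowΓ-complete (proj₁ (exitΓ h t q)) L Q accepts
...     | ok , occ≡ , last≡ = (admissible⇒nonzeroΓ adm , ok) , cong₂ _∷_ b≡ occ≡ , last≡

rowΔ-sound : ∀ (H : Vec (Edge m) (suc N)) L B → AdmissibleRow Δ H L B → last H ≡ nothing →
  rowΔ L (occupancy B) ≡ (H , B) × run stepΔ (is-just (head H)) (occupancy L) (occupancy B) ≡ just false
rowΔ-sound (_ ∷ []) [] [] _ refl = refl , refl
rowΔ-sound (l ∷ H) (t ∷ L) (b ∷ B) (nz , ok) last≡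
  with rowΔ-sound H L B ok last≡ | admissibleΔ⇒exit (nonzero⇒admissibleΔ l t (head H) b nz)
... | row≡ , run≡ | exit≡ , step≡ rewrite row≡ | exit≡ | step≡ = refl , run≡

rowΔ-complete : ∀ (L : Vec (Edge m) N) Q {s} → run stepΔ s (occupancy L) Q ≡ just false →
  s ≡ is-just (head (proj₁ (rowΔ L Q))) ×
  AdmissibleRow Δ (proj₁ (rowΔ L Q)) L (proj₂ (rowΔ L Q)) × occupancy (proj₂ (rowΔ L Q)) ≡ Q
rowΔ-complete [] [] refl = refl , _ , refl
rowΔ-complete (t ∷ L) (q ∷ Q) {s} accepts with stepΔ s (is-just t) q in step≡
... | just s′ with rowΔ-complete L Q accepts
...   | s′≡ , ok , occ≡ rewrite s′≡ with exit⇒admissibleΔ (head (proj₁ (rowΔ L Q))) t q step≡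
...     | s≡ , adm , b≡ = s≡ , (admissible⇒nonzeroΔ adm , ok) , cong₂ _∷_ b≡ occ≡

rowΔ-last : ∀ (L : Vec (Edge m) N) Q → last (proj₁ (rowΔ L Q)) ≡ nothing
rowΔ-last []          []      = refl
rowΔ-last (_ ∷ [])    (_ ∷ []) = refl
rowΔ-last (_ ∷ t ∷ L) (_ ∷ Q) = rowΔ-last (t ∷ L) Q

-- The side boundary condition, for a row read from left to right.
BoundaryEnds : RowType → Fin m → Vec (Edge m) (suc N) → Set
BoundaryEnds Γ s H = head H ≡ nothing × last H ≡ just s
BoundaryEnds Δ s H = last H ≡ nothing × head H ≡ just s

BoundaryEnds-irrelevant : ∀ θ (s : Fin m) (H : Vec (Edge m) (suc N)) → Irrelevant (BoundaryEnds θ s H)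
BoundaryEnds-irrelevant Γ s H = ×-irrelevant uip uip
BoundaryEnds-irrelevant Δ s H = ×-irrelevant uip uip

Row : RowType → Vec (Edge m) N → Vec (Edge m) N → Set
Row {m} {N} θ L B =
  Σ[ s ∈ Fin m ] Σ[ H ∈ Vec (Edge m) (suc N) ] AdmissibleRow θ H L B × BoundaryEnds θ s H

Accepts : RowType → Vec Bool N → Vec Bool N → Set
Accepts Γ P Q = run stepΓ false P Q ≡ just true
Accepts Δ P Q = run stepΔ true P Q ≡ just false

Accepts-irrelevant : ∀ θ {P Q : Vec Bool N} → Irrelevant (Accepts θ P Q)
Accepts-irrelevant Γ = uip
Accepts-irrelevant Δ = uip

bottoms : RowType → Vec (Edge m) N → Vec Bool N → Vec (Edge m) N
bottoms Γ L Q = proj₂ (rowΓ nothing L Q)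
bottoms Δ L Q = proj₂ (rowΔ L Q)

Row-≡ : ∀ θ {L B : Vec (Edge m) N} (x y : Row θ L B) →
  proj₁ x ≡ proj₁ y → proj₁ (proj₂ x) ≡ proj₁ (proj₂ y) → x ≡ y
Row-≡ θ {L} {B} (s , H , p) (.s , .H , q) refl refl =
  cong (λ p → s , H , p) (×-irrelevant (AdmissibleRow-irrelevant θ H L B) (BoundaryEnds-irrelevant θ s H) p q)

Row-irrelevant : ∀ θ (L B : Vec (Edge m) N) → Irrelevant (Row θ L B)
Row-irrelevant Γ L B x@(s , nothing ∷ H , ok , refl , last≡) y@(s′ , nothing ∷ H′ , ok′ , refl , last≡′)
  with refl ← trans (sym (proj₁ (rowΓ-sound nothing H L B ok))) (proj₁ (rowΓ-sound nothing H′ L B ok′))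
  = Row-≡ Γ x y (just-injective (trans (sym last≡) last≡′)) refl
Row-irrelevant Δ L B x@(s , H , ok , last≡ , head≡) y@(s′ , H′ , ok′ , last≡′ , head≡′)
  with refl ← trans (sym (proj₁ (rowΔ-sound H L B ok last≡))) (proj₁ (rowΔ-sound H′ L B ok′ last≡′))
  = Row-≡ Δ x y (just-injective (trans (sym head≡) head≡′)) refl

Row⇒accepts : ∀ θ (L B : Vec (Edge m) N) → Row θ L B →
  Accepts θ (occupancy L) (occupancy B) × B ≡ bottoms θ L (occupancy B)
Row⇒accepts Γ L B (s , nothing ∷ H , ok , refl , last≡)
  with row≡ , run≡ ← rowΓ-sound nothing H L B ok
  = trans run≡ (cong (just ∘ is-just) last≡) , sym (cong proj₂ row≡)
Row⇒accepts Δ L B (s , H , ok , last≡ , head≡)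
  with row≡ , run≡ ← rowΔ-sound H L B ok last≡
  = trans (cong (λ h → run stepΔ (is-just h) (occupancy L) (occupancy B)) (sym head≡)) run≡ ,
    sym (cong proj₂ row≡)

accepts⇒Row : ∀ θ (L B : Vec (Edge m) N) →
  Accepts θ (occupancy L) (occupancy B) × B ≡ bottoms θ L (occupancy B) → Row θ L B
accepts⇒Row Γ L B (accepts , B≡)
  with ok , _ , last≡ ← rowΓ-complete nothing L (occupancy B) accepts
  with just s ← last (nothing ∷ proj₁ (rowΓ nothing L (occupancy B))) in last≡′
  = s , _ , subst (AdmissibleRow Γ _ L) (sym B≡) ok , refl , last≡′
accepts⇒Row Δ L B (accepts , B≡)
  with head≡ , ok , _ ← rowΔ-complete L (occupancy B) accepts
  with just s ← head (proj₁ (rowΔ L (occupancy B))) in head≡′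
  = s , _ , subst (AdmissibleRow Δ _ L) (sym B≡) ok , rowΔ-last L (occupancy B) , head≡′

Row↔ : ∀ θ (L B : Vec (Edge m) N) →
  Row θ L B ↔ (Accepts θ (occupancy L) (occupancy B) × B ≡ bottoms θ L (occupancy B))
Row↔ θ L B = ⇔⇒↔ (Row-irrelevant θ L B) (×-irrelevant (Accepts-irrelevant θ) uip)
  (mk⇔ (Row⇒accepts θ L B) (accepts⇒Row θ L B))

occupancy-bottoms : ∀ θ (L : Vec (Edge m) N) Q → Accepts θ (occupancy L) Q → occupancy (bottoms θ L Q) ≡ Q
occupancy-bottoms Γ L Q accepts = proj₁ (proj₂ (rowΓ-complete nothing L Q accepts))
occupancy-bottoms Δ L Q accepts = proj₂ (proj₂ (rowΔ-complete L Q accepts))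

Row-reindex : ∀ θ (L : Vec (Edge m) N) (X : Vec (Edge m) N → Set) →
  (Σ[ B ∈ Vec (Edge m) N ] (Row θ L B × X B)) ↔
  (Σ[ Q ∈ Vec Bool N ] (Accepts θ (occupancy L) Q × X (bottoms θ L Q)))
Row-reindex θ L X = ↔-trans (Σ.congˡ (Row↔ θ L _ ×-↔ ↔-refl))
  (Σ-×-reindex X (λ _ → ×-irrelevant (Accepts-irrelevant θ) uip) (λ _ → Accepts-irrelevant θ)
    occupancy (bottoms θ L) proj₁ forced (sym ∘ proj₂) (occupancy-bottoms θ L _))
  where
  forced : ∀ {Q} → Accepts θ (occupancy L) Q →
    Accepts θ (occupancy L) (occupancy (bottoms θ L Q)) × bottoms θ L Q ≡ bottoms θ L (occupancy (bottoms θ L Q))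
  forced {Q} accepts rewrite occupancy-bottoms θ L Q accepts = accepts , refl

-- Occupancy automata and interlacing

-- Read from the left, position N − 1 first, so that the list is decreasing.
positions : Vec Bool N → List ℕ
positions []                  = []
positions {suc N} (true  ∷ Q) = N ∷ positions Q
positions {suc N} (false ∷ Q) = positions Q

positions-< : (Q : Vec Bool N) → All (_< N) (positions Q)
positions-< []          = []
positions-< (true  ∷ Q) = n<1+n _ ∷ All.map m<n⇒m<1+n (positions-< Q)
positions-< (false ∷ Q) = All.map m<n⇒m<1+n (positions-< Q)

data PairTypeˡ (θ : RowType) : List ℕ → List ℕ → Set where
  [-] : ∀ {a} → PairTypeˡ θ (a ∷ []) []
  _∷_ : ∀ {a b x us ls} → PairCond θ a x b → PairTypeˡ θ (b ∷ us) ls →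
        PairTypeˡ θ (a ∷ b ∷ us) (x ∷ ls)

PairTypeˡ-tail : ∀ {θ a x us ls} → PairTypeˡ θ (a ∷ us) (x ∷ ls) → PairTypeˡ θ us ls
PairTypeˡ-tail (_ ∷ p) = p

PairTypeˡ-lower-head : ∀ θ {n us ls} → All (_< n) ls →
  PairTypeˡ θ (suc n ∷ us) ls → PairTypeˡ θ (n ∷ us) ls
PairTypeˡ-lower-head θ _          [-]               = [-]
PairTypeˡ-lower-head Γ (x<n ∷ _) ((_ , b≤x) ∷ p) = (x<n , b≤x) ∷ p
PairTypeˡ-lower-head Δ (x<n ∷ _) ((_ , b<x) ∷ p) = (<⇒≤ x<n , b<x) ∷ p

PairTypeˡ-raise-head : ∀ θ {n us ls} → PairTypeˡ θ (n ∷ us) ls → PairTypeˡ θ (suc n ∷ us) ls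
PairTypeˡ-raise-head θ [-]               = [-]
PairTypeˡ-raise-head Γ ((x<n , b≤x) ∷ p) = (m<n⇒m<1+n x<n , b≤x) ∷ p
PairTypeˡ-raise-head Δ ((x≤n , b<x) ∷ p) = (m≤n⇒m≤1+n x≤n , b<x) ∷ p

PairTypeˡ-cons : ∀ θ {n us ls} → All (_< n) us → PairTypeˡ θ us ls → PairTypeˡ θ (suc n ∷ us) (n ∷ ls)
PairTypeˡ-cons Γ (a<n ∷ _) p = (n<1+n _ , <⇒≤ a<n) ∷ p
PairTypeˡ-cons Δ (a<n ∷ _) p = (n≤1+n _ , a<n) ∷ p

PairTypeˡΔ-cons-equal : ∀ {n us ls} → All (_< n) us → PairTypeˡ Δ us ls → PairTypeˡ Δ (n ∷ us) (n ∷ ls)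
PairTypeˡΔ-cons-equal (a<n ∷ _) p = (≤-refl , a<n) ∷ p

PairTypeˡ-gap : ∀ θ {n a us ls} → All (_< n) ls → ¬ PairTypeˡ θ (a ∷ n ∷ us) ls
PairTypeˡ-gap Γ (x<n ∷ _) ((_ , n≤x) ∷ _) = <⇒≱ x<n n≤x
PairTypeˡ-gap Δ (x<n ∷ _) ((_ , n<x) ∷ _) = <-asym x<n n<x

PairTypeˡ-too-high : ∀ θ {n us ls} → All (_< n) us → ¬ PairTypeˡ θ us (n ∷ ls)
PairTypeˡ-too-high Γ (a<n ∷ _) ((n<a , _) ∷ _) = <-asym a<n n<a
PairTypeˡ-too-high Δ (a<n ∷ _) ((n≤a , _) ∷ _) = <⇒≱ a<n n≤a

PairTypeˡΓ-strict : ∀ {n us ls} → ¬ PairTypeˡ Γ (n ∷ us) (n ∷ ls)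
PairTypeˡΓ-strict ((n<n , _) ∷ _) = <-irrefl refl n<n

PairTypeˡΔ-strict : ∀ {a n us ls} → ¬ PairTypeˡ Δ (a ∷ n ∷ us) (n ∷ ls)
PairTypeˡΔ-strict ((_ , n<n) ∷ _) = <-irrefl refl n<n

-- The state true is a path crossing the left boundary; it acts as an extra
-- particle at position N of the upper level.
runΓ⇔PairType : ∀ (P Q : Vec Bool N) →
  (run stepΓ false P Q ≡ just true ⇔ PairTypeˡ Γ (positions P) (positions Q)) ×
  (run stepΓ true  P Q ≡ just true ⇔ PairTypeˡ Γ (N ∷ positions P) (positions Q))
runΓ⇔PairType [] [] = both-empty (λ ()) (λ ()) , mk⇔ (λ _ → [-]) (λ _ → refl)
runΓ⇔PairType (false ∷ P) (false ∷ Q) =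
  proj₁ IH , ⇔-trans (proj₂ IH) (mk⇔ (PairTypeˡ-raise-head Γ) (PairTypeˡ-lower-head Γ (positions-< Q)))
  where IH = runΓ⇔PairType P Q
runΓ⇔PairType (true ∷ P) (false ∷ Q) =
  proj₂ (runΓ⇔PairType P Q) , both-empty (λ ()) (PairTypeˡ-gap Γ (positions-< Q))
runΓ⇔PairType (false ∷ P) (true ∷ Q) =
  both-empty (λ ()) (PairTypeˡ-too-high Γ (positions-< P)) ,
  ⇔-trans (proj₁ (runΓ⇔PairType P Q)) (mk⇔ (PairTypeˡ-cons Γ (positions-< P)) PairTypeˡ-tail)
runΓ⇔PairType {suc n} (true ∷ P) (true ∷ Q) =
  both-empty (λ ()) PairTypeˡΓ-strict ,
  ⇔-trans (proj₂ (runΓ⇔PairType P Q)) (mk⇔ ((n<1+n n , ≤-refl) ∷_) PairTypeˡ-tail)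

-- Here the state false plays the role of the extra particle at position N.
runΔ⇔PairType : ∀ (P Q : Vec Bool N) →
  (run stepΔ true  P Q ≡ just false ⇔ PairTypeˡ Δ (positions P) (positions Q)) ×
  (run stepΔ false P Q ≡ just false ⇔ PairTypeˡ Δ (N ∷ positions P) (positions Q))
runΔ⇔PairType [] [] = both-empty (λ ()) (λ ()) , mk⇔ (λ _ → [-]) (λ _ → refl)
runΔ⇔PairType (false ∷ P) (false ∷ Q) =
  proj₁ IH , ⇔-trans (proj₂ IH) (mk⇔ (PairTypeˡ-raise-head Δ) (PairTypeˡ-lower-head Δ (positions-< Q)))
  where IH = runΔ⇔PairType P Q
runΔ⇔PairType (true ∷ P) (false ∷ Q) =
  proj₂ (runΔ⇔PairType P Q) , both-empty (λ ()) (PairTypeˡ-gap Δ (positions-< Q))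
runΔ⇔PairType (false ∷ P) (true ∷ Q) =
  both-empty (λ ()) (PairTypeˡ-too-high Δ (positions-< P)) ,
  ⇔-trans (proj₁ (runΔ⇔PairType P Q)) (mk⇔ (PairTypeˡ-cons Δ (positions-< P)) PairTypeˡ-tail)
runΔ⇔PairType {suc n} (true ∷ P) (true ∷ Q) =
  ⇔-trans (proj₁ (runΔ⇔PairType P Q)) (mk⇔ (PairTypeˡΔ-cons-equal (positions-< P)) PairTypeˡ-tail) ,
  both-empty (λ ()) PairTypeˡΔ-strict

Accepts⇔PairTypeˡ : ∀ θ (P Q : Vec Bool N) → Accepts θ P Q ⇔ PairTypeˡ θ (positions P) (positions Q)
Accepts⇔PairTypeˡ Γ P Q = proj₁ (runΓ⇔PairType P Q)
Accepts⇔PairTypeˡ Δ P Q = proj₁ (runΔ⇔PairType P Q)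

-- Phrased with _≡ᵇ_, like topColour.
_∈ᵇ_ : ℕ → List ℕ → Bool
k ∈ᵇ []       = false
k ∈ᵇ (x ∷ xs) = if k ≡ᵇ x then true else k ∈ᵇ xs

indicator : (N : ℕ) → List ℕ → Vec Bool N
indicator zero    _  = []
indicator (suc N) xs = (N ∈ᵇ xs) ∷ indicator N xs

≡ᵇ-refl : ∀ n → (n ≡ᵇ n) ≡ true
≡ᵇ-refl n = dec-true (n ℕ.≟ n) refl

∈ᵇ-here : ∀ k xs → k ∈ᵇ (k ∷ xs) ≡ true
∈ᵇ-here k xs rewrite ≡ᵇ-refl k = refl

∈ᵇ-there : ∀ {k x} xs → k ≢ x → k ∈ᵇ (x ∷ xs) ≡ k ∈ᵇ xs
∈ᵇ-there {k} {x} xs k≢x rewrite dec-false (k ℕ.≟ x) k≢x = refl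

∈ᵇ-absent : ∀ {k xs} → All (_< k) xs → k ∈ᵇ xs ≡ false
∈ᵇ-absent [] = refl
∈ᵇ-absent {xs = _ ∷ xs} (x<k ∷ xs<k) = trans (∈ᵇ-there xs (>⇒≢ x<k)) (∈ᵇ-absent xs<k)

indicator-there : ∀ N {x} xs → N ≤ x → indicator N (x ∷ xs) ≡ indicator N xs
indicator-there zero    xs _   = refl
indicator-there (suc N) xs N<x = cong₂ _∷_ (∈ᵇ-there xs (<⇒≢ N<x)) (indicator-there N xs (<⇒≤ N<x))

indicator-positions : (Q : Vec Bool N) → indicator N (positions Q) ≡ Q
indicator-positions []                  = refl
indicator-positions {suc N} (true  ∷ Q) =
  cong₂ _∷_ (∈ᵇ-here N (positions Q)) (trans (indicator-there N (positions Q) ≤-refl) (indicator-positions Q))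
indicator-positions {suc N} (false ∷ Q) =
  cong₂ _∷_ (∈ᵇ-absent (positions-< Q)) (indicator-positions Q)

Linked>⇒All< : ∀ {x xs} → Linked _>_ (x ∷ xs) → All (_< x) xs
Linked>⇒All< [-]          = []
Linked>⇒All< (x>y ∷ rest) = Linked⇒All (flip <-trans) x>y rest

Linked-∷ : ∀ {x xs} → All (_< x) xs → Linked _>_ xs → Linked _>_ (x ∷ xs)
Linked-∷ []        _   = [-]
Linked-∷ (y<x ∷ _) dec = y<x ∷ dec

positions-indicator : ∀ N {xs} → Linked _>_ xs → All (_< N) xs → positions (indicator N xs) ≡ xs
positions-indicator zero    _ [] = refl
positions-indicator (suc N) {[]} _ [] = positions-indicator N [] []
positions-indicator (suc N) {x ∷ xs} dec (x<1+N ∷ _) with m<1+n⇒m<n∨m≡n x<1+N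
... | inj₂ refl rewrite ∈ᵇ-here x xs =
  cong (x ∷_) (trans (cong positions (indicator-there x xs ≤-refl))
                     (positions-indicator x (Linked.tail dec) (Linked>⇒All< dec)))
... | inj₁ x<N rewrite ∈ᵇ-absent (Linked⇒All (flip <-trans) x<N dec) =
  positions-indicator N dec (Linked⇒All (flip <-trans) x<N dec)

PairCond-below : ∀ θ {a x b} → PairCond θ a x b → x ≤ a
PairCond-below Γ (x<a , _) = <⇒≤ x<a
PairCond-below Δ (x≤a , _) = x≤a

PairCond-chain : ∀ θ {a x b y c} → PairCond θ a x b → PairCond θ b y c → y < x
PairCond-chain Γ (_ , b≤x) (y<b , _) = <-≤-trans y<b b≤x
PairCond-chain Δ (_ , b<x) (y≤b , _) = ≤-<-trans y≤b b<x

PairTypeˡ-decreasing : ∀ {θ us ls} → PairTypeˡ θ us ls → Linked _>_ ls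
PairTypeˡ-decreasing [-]                  = []
PairTypeˡ-decreasing (_ ∷ [-])            = [-]
PairTypeˡ-decreasing {θ} (c ∷ p@(c′ ∷ _)) = PairCond-chain θ c c′ ∷ PairTypeˡ-decreasing p

PairTypeˡ-< : ∀ {θ n us ls} → All (_< n) us → PairTypeˡ θ us ls → All (_< n) ls
PairTypeˡ-< _              [-]     = []
PairTypeˡ-< {θ} (a<n ∷ us<n) (c ∷ p) = ≤-<-trans (PairCond-below θ c) a<n ∷ PairTypeˡ-< us<n p

PairTypeˡ-indicator : ∀ {θ N us ls} → All (_< N) us → PairTypeˡ θ us ls → positions (indicator N ls) ≡ ls
PairTypeˡ-indicator {N = N} us<N p = positions-indicator N (PairTypeˡ-decreasing p) (PairTypeˡ-< us<N p)

PairTypeˡ-length : ∀ {θ us ls} → PairTypeˡ θ us ls → List.length us ≡ suc (List.length ls)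
PairTypeˡ-length [-]     = refl
PairTypeˡ-length (_ ∷ p) = cong suc (PairTypeˡ-length p)

takePadded : (n : ℕ) → List ℕ → Vec ℕ n
takePadded zero    _        = []
takePadded (suc n) []       = 0 ∷ takePadded n []
takePadded (suc n) (x ∷ xs) = x ∷ takePadded n xs

takePadded-toList : ∀ {n} (v : Vec ℕ n) → takePadded n (toList v) ≡ v
takePadded-toList []       = refl
takePadded-toList (x ∷ xs) = cong (x ∷_) (takePadded-toList xs)

toList-takePadded : ∀ {n} xs → List.length xs ≡ n → toList (takePadded n xs) ≡ xs
toList-takePadded []       refl = refl
toList-takePadded (x ∷ xs) refl = cong (x ∷_) (toList-takePadded xs refl)

PairType⇔PairTypeˡ : ∀ θ {n} (u : Vec ℕ (suc n)) (l : Vec ℕ n) →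
  PairType θ u l ⇔ PairTypeˡ θ (toList u) (toList l)
PairType⇔PairTypeˡ θ u l = mk⇔ (to u l) (from u l)
  where
  to : ∀ {n} (u : Vec ℕ (suc n)) l → PairType θ u l → PairTypeˡ θ (toList u) (toList l)
  to (_ ∷ [])     []      []      = [-]
  to (_ ∷ b ∷ us) (_ ∷ l) (c ∷ p) = c ∷ to (b ∷ us) l p
  from : ∀ {n} (u : Vec ℕ (suc n)) l → PairTypeˡ θ (toList u) (toList l) → PairType θ u l
  from (_ ∷ [])     []      [-]     = []
  from (_ ∷ b ∷ us) (_ ∷ l) (c ∷ p) = c ∷ from (b ∷ us) l p

PairCond-irrelevant : ∀ θ {a x b} → Irrelevant (PairCond θ a x b)
PairCond-irrelevant Γ = ×-irrelevant ℕ.<-irrelevant ℕ.≤-irrelevant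
PairCond-irrelevant Δ = ×-irrelevant ℕ.≤-irrelevant ℕ.<-irrelevant

PairTypeˡ-irrelevant : ∀ {θ us ls} → Irrelevant (PairTypeˡ θ us ls)
PairTypeˡ-irrelevant [-] [-] = refl
PairTypeˡ-irrelevant {θ} (c ∷ p) (c′ ∷ p′) =
  cong₂ _∷_ (PairCond-irrelevant θ c c′) (PairTypeˡ-irrelevant p p′)

PairType-irrelevant : ∀ {θ n} {u : Vec ℕ (suc n)} {l} → Irrelevant (PairType θ u l)
PairType-irrelevant [] [] = refl
PairType-irrelevant {θ} (c ∷ p) (c′ ∷ p′) =
  cong₂ _∷_ (PairCond-irrelevant θ c c′) (PairType-irrelevant p p′)

Interlace-irrelevant : ∀ {n} {u : Vec ℕ (suc n)} {l} → Irrelevant (Interlace u l)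
Interlace-irrelevant [] [] = refl
Interlace-irrelevant (c ∷ p) (c′ ∷ p′) =
  cong₂ _∷_ (×-irrelevant ℕ.≤-irrelevant ℕ.≤-irrelevant c c′) (Interlace-irrelevant p p′)

PairType⇒Interlace : ∀ θ {n} {u : Vec ℕ (suc n)} {l} → PairType θ u l → Interlace u l
PairType⇒Interlace θ []                  = []
PairType⇒Interlace Γ ((x<a , b≤x) ∷ p) = (<⇒≤ x<a , b≤x) ∷ PairType⇒Interlace Γ p
PairType⇒Interlace Δ ((x≤a , b<x) ∷ p) = (x≤a , <⇒≤ b<x) ∷ PairType⇒Interlace Δ p

GTPΘ-uncons : ∀ {n} θ (Θ : Vec RowType n) (p : Vec ℕ (suc n)) →
  GTPΘ (θ ∷ Θ) p ↔ (Σ[ l ∈ Vec ℕ n ] (PairType θ p l × GTPΘ Θ l))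
GTPΘ-uncons θ [] (a ∷ []) = mk↔ₛ′
  (λ _ → [] , [] , _ , (_ , _) , _)
  (λ _ → (a ∷ [] , _) , (refl , _) , _)
  (λ { ([] , [] , _) → refl })
  (λ { (_ , (refl , _) , _) → refl })
GTPΘ-uncons θ (θ′ ∷ Θ) p = mk↔ₛ′
  (λ { ((_ , l , T) , (refl , _ , gt) , pt , types) → l , pt , (l , T) , (refl , gt) , types })
  (λ { (l , pt , (_ , T) , (refl , gt) , types) → (p , l , T) , (refl , PairType⇒Interlace θ pt , gt) , pt , types })
  (λ { (_ , _ , (_ , _) , (refl , _) , _) → refl })
  (λ { ((_ , l , T) , (refl , il , gt) , pt , types) →
       cong (λ il′ → (p , l , T) , (refl , il′ , gt) , pt , types) (Interlace-irrelevant _ il) })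

module _ (θ : RowType) {n} {P : Vec Bool N} {p : Vec ℕ (suc n)} (P≡p : positions P ≡ toList p) where

  upper-< : All (_< N) (toList p)
  upper-< = subst (All (_< N)) P≡p (positions-< P)

  PairTypeˡ⇒accepts : ∀ {ls} → PairTypeˡ θ (toList p) ls → Accepts θ P (indicator N ls)
  PairTypeˡ⇒accepts pt = Equivalence.from (Accepts⇔PairTypeˡ θ P _)
    (subst₂ (PairTypeˡ θ) (sym P≡p) (sym (PairTypeˡ-indicator upper-< pt)) pt)

  Accepts-reindex : (X : Vec Bool N → Set) →
    (Σ[ Q ∈ Vec Bool N ] (Accepts θ P Q × X Q)) ↔
    (Σ[ l ∈ Vec ℕ n ] (PairType θ p l × X (indicator N (toList l))))
  Accepts-reindex X = ↔-trans
    (Σ-×-reindex X (λ _ → Accepts-irrelevant θ) (λ _ → PairTypeˡ-irrelevant)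
      positions (indicator N) accepts⇒PairTypeˡ PairTypeˡ⇒accepts
      (λ {Q} _ → indicator-positions Q) (PairTypeˡ-indicator upper-<))
    (Σ-×-reindex (X ∘ indicator N) (λ _ → PairTypeˡ-irrelevant) (λ _ → PairType-irrelevant)
      (takePadded n) toList PairTypeˡ⇒PairType (Equivalence.to (PairType⇔PairTypeˡ θ p _))
      toList∘takePadded (λ {l} _ → takePadded-toList l))
    where
    accepts⇒PairTypeˡ : ∀ {Q} → Accepts θ P Q → PairTypeˡ θ (toList p) (positions Q)
    accepts⇒PairTypeˡ {Q} =
      subst (λ u → PairTypeˡ θ u (positions Q)) P≡p ∘ Equivalence.to (Accepts⇔PairTypeˡ θ P Q)
    toList∘takePadded : ∀ {ls} → PairTypeˡ θ (toList p) ls → toList (takePadded n ls) ≡ ls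
    toList∘takePadded {ls} pt =
      toList-takePadded ls (suc-injective (trans (sym (PairTypeˡ-length pt)) (length-toList p)))
    PairTypeˡ⇒PairType : ∀ {ls} → PairTypeˡ θ (toList p) ls → PairType θ p (takePadded n ls)
    PairTypeˡ⇒PairType pt = Equivalence.from (PairType⇔PairTypeˡ θ p _)
      (subst (PairTypeˡ θ (toList p)) (sym (toList∘takePadded pt)) pt)

-- Lattices row by row

-- A lattice is given by its rows and its levels of vertical edges, all read from
-- left to right; the first level is the top boundary.
Rows : Vec RowType r → Vec (Fin m) r → Vec (Vec (Edge m) (suc N)) r → Vec (Vec (Edge m) N) (suc r) → Set
Rows {N = N} [] [] [] (L ∷ []) = L ≡ replicate N nothing
Rows (θ ∷ Θ) (s ∷ σ) (H ∷ Hs) (L ∷ L′ ∷ Ls) =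
  (AdmissibleRow θ H L L′ × BoundaryEnds θ s H) × Rows Θ σ Hs (L′ ∷ Ls)

Rows-irrelevant : ∀ (Θ : Vec RowType r) (σ : Vec (Fin m) r) Hs (Ls : Vec (Vec (Edge m) N) (suc r)) →
  Irrelevant (Rows Θ σ Hs Ls)
Rows-irrelevant [] [] [] (_ ∷ []) = uip
Rows-irrelevant (θ ∷ Θ) (s ∷ σ) (H ∷ Hs) (L ∷ L′ ∷ Ls) =
  ×-irrelevant (×-irrelevant (AdmissibleRow-irrelevant θ H L L′) (BoundaryEnds-irrelevant θ s H))
               (Rows-irrelevant Θ σ Hs (L′ ∷ Ls))

Lattice : Vec RowType r → Vec (Edge m) N → Set
Lattice {r} {m} {N} Θ L =
  Σ[ σ ∈ Vec (Fin m) r ] Σ[ Hs ∈ Vec (Vec (Edge m) (suc N)) r ] Σ[ Ls ∈ Vec (Vec (Edge m) N) r ]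
  Rows Θ σ Hs (L ∷ Ls)

Lattice-uncons : ∀ θ (Θ : Vec RowType r) (L : Vec (Edge m) N) →
  Lattice (θ ∷ Θ) L ↔ (Σ[ B ∈ Vec (Edge m) N ] (Row θ L B × Lattice Θ B))
Lattice-uncons θ Θ L = mk↔ₛ′
  (λ { (s ∷ σ , H ∷ Hs , B ∷ Ls , (adm , ends) , rows) → B , (s , H , adm , ends) , σ , Hs , Ls , rows })
  (λ { (B , (s , H , adm , ends) , σ , Hs , Ls , rows) → s ∷ σ , H ∷ Hs , B ∷ Ls , (adm , ends) , rows })
  (λ _ → refl)
  (λ { (_ ∷ _ , _ ∷ _ , _ ∷ _ , _) → refl })

Lattice-[]-irrelevant : (L : Vec (Edge m) N) → Irrelevant (Lattice [] L)
Lattice-[]-irrelevant L ([] , [] , [] , e) ([] , [] , [] , e′) = cong (λ e → [] , [] , [] , e) (uip e e′)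

unoccupied : (L : Vec (Edge m) N) → positions (occupancy L) ≡ [] → L ≡ replicate N nothing
unoccupied []            _  = refl
unoccupied (nothing ∷ L) eq = cong (nothing ∷_) (unoccupied L eq)

Lattice↔GTPΘ : ∀ (Θ : Vec RowType r) (L : Vec (Edge m) N) (p : Vec ℕ r) →
  positions (occupancy L) ≡ toList p → Lattice Θ L ↔ GTPΘ Θ p
Lattice↔GTPΘ [] L [] L-empty = ⇔⇒↔ (Lattice-[]-irrelevant L) (λ _ _ → refl)
  (mk⇔ (λ _ → _ , (_ , _) , _) (λ _ → [] , [] , [] , unoccupied L L-empty))
Lattice↔GTPΘ {N = N} (θ ∷ Θ) L p L≡p = begin
  Lattice (θ ∷ Θ) L
    ↔⟨ Lattice-uncons θ Θ L ⟩
  (Σ[ B ∈ _ ] (Row θ L B × Lattice Θ B))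
    ↔⟨ Row-reindex θ L (Lattice Θ) ⟩
  (Σ[ Q ∈ _ ] (Accepts θ (occupancy L) Q × Lattice Θ (bottoms θ L Q)))
    ↔⟨ Accepts-reindex θ L≡p (Lattice Θ ∘ bottoms θ L) ⟩
  (Σ[ l ∈ _ ] (PairType θ p l × Lattice Θ (bottoms θ L (indicator N (toList l)))))
    ↔⟨ Σ-×-congʳ (λ pt → Lattice↔GTPΘ Θ _ _ (next-level pt)) ⟩
  (Σ[ l ∈ _ ] (PairType θ p l × GTPΘ Θ l))
    ↔⟨ ↔-sym (GTPΘ-uncons θ Θ p) ⟩
  GTPΘ (θ ∷ Θ) p ∎
  where
  open EquationalReasoning
  next-level : ∀ {l} → PairType θ p l → positions (occupancy (bottoms θ L (indicator N (toList l)))) ≡ toList l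
  next-level {l} pt = trans
    (cong positions (occupancy-bottoms θ L _ (PairTypeˡ⇒accepts θ L≡p ptˡ)))
    (PairTypeˡ-indicator {N = N} (upper-< θ {P = occupancy L} L≡p) ptˡ)
    where ptˡ = Equivalence.to (PairType⇔PairTypeˡ θ p l) pt

-- Configurations as lattices

AdmissibleRow⇔lookup : ∀ θ (H : Vec (Edge m) (suc N)) L B → AdmissibleRow θ H L B ⇔
  (∀ j → NonZeroW (weight θ (lookup H (inject₁ j)) (lookup L j) (lookup H (suc j)) (lookup B j)))
AdmissibleRow⇔lookup θ (_ ∷ _) [] [] = mk⇔ (λ _ ()) (λ _ → _)
AdmissibleRow⇔lookup θ (_ ∷ r ∷ H) (_ ∷ L) (_ ∷ B) = mk⇔
  (λ { (nz , ok) zero → nz ; (nz , ok) (suc j) → Equivalence.to IH ok j })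
  (λ nz → nz zero , Equivalence.from IH (nz ∘ suc))
  where IH = AdmissibleRow⇔lookup θ (r ∷ H) L B

RowsPointwise : Vec RowType r → Vec (Fin m) r → Vec (Vec (Edge m) (suc N)) r → Vec (Vec (Edge m) N) (suc r) → Set
RowsPointwise {N = N} Θ σ Hs Ls =
  (∀ i → AdmissibleRow (lookup Θ i) (lookup Hs i) (lookup Ls (inject₁ i)) (lookup Ls (suc i)) ×
         BoundaryEnds (lookup Θ i) (lookup σ i) (lookup Hs i)) ×
  last Ls ≡ replicate N nothing

Rows⇔pointwise : ∀ (Θ : Vec RowType r) (σ : Vec (Fin m) r) Hs (Ls : Vec (Vec (Edge m) N) (suc r)) →
  Rows Θ σ Hs Ls ⇔ RowsPointwise Θ σ Hs Ls
Rows⇔pointwise [] [] [] (_ ∷ []) = mk⇔ (λ e → (λ ()) , e) proj₂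
Rows⇔pointwise (θ ∷ Θ) (s ∷ σ) (H ∷ Hs) (L ∷ L′ ∷ Ls) = mk⇔
  (λ (row , rows) →
    (λ { zero → row ; (suc i) → proj₁ (Equivalence.to IH rows) i }) , proj₂ (Equivalence.to IH rows))
  (λ (pw , last≡) → pw zero , Equivalence.from IH (pw ∘ suc , last≡))
  where IH = Rows⇔pointwise Θ σ Hs (L′ ∷ Ls)

latticeConfig : Vec (Vec (Edge m) (suc N)) r → Vec (Vec (Edge m) N) (suc r) → Config m r N
latticeConfig Hs Ls = config (map mirror Hs) (columns Ls)

vertexWeight-latticeConfig : ∀ θ (Hs : Vec (Vec (Edge m) (suc N)) r) Ls i j →
  vertexWeight θ (latticeConfig Hs Ls) i (opposite j) ≡
  weight θ (lookup (lookup Hs i) (inject₁ j)) (lookup (lookup Ls (inject₁ i)) j)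
           (lookup (lookup Hs i) (suc j)) (lookup (lookup Ls (suc i)) j)
vertexWeight-latticeConfig θ Hs Ls i j
  rewrite lookup-map i mirror Hs
        | lookup-mirror (lookup Hs i) (suc (opposite j))
        | lookup-mirror (lookup Hs i) (inject₁ (opposite j))
        | lookup²-tabulate (λ k s → lookup (lookup Ls s) (opposite k)) (opposite j) (inject₁ i)
        | lookup²-tabulate (λ k s → lookup (lookup Ls s) (opposite k)) (opposite j) (suc i)
        | opposite-involutive j
        | opposite-involutive (suc j) = refl

SideBoundary-mirror : ∀ θ (s : Fin m) (H : Vec (Edge m) (suc N)) → SideBoundary θ s (mirror H) ⇔ BoundaryEnds θ s H
SideBoundary-mirror Γ s H = mk⇔
  (λ { (sideΓ l≡ h≡) → trans (sym (last-mirror H)) l≡ , trans (sym (head-mirror H)) h≡ })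
  (λ (h≡ , l≡) → sideΓ (trans (last-mirror H) h≡) (trans (head-mirror H) l≡))
SideBoundary-mirror Δ s H = mk⇔
  (λ { (sideΔ h≡ l≡) → trans (sym (head-mirror H)) h≡ , trans (sym (last-mirror H)) l≡ })
  (λ (l≡ , h≡) → sideΔ (trans (head-mirror H) l≡) (trans (last-mirror H) h≡))

SideBoundary-irrelevant : ∀ θ (s : Fin m) (h : Vec (Edge m) (suc N)) → Irrelevant (SideBoundary θ s h)
SideBoundary-irrelevant Γ s h (sideΓ a b) (sideΓ a′ b′) = cong₂ sideΓ (uip a a′) (uip b b′)
SideBoundary-irrelevant Δ s h (sideΔ a b) (sideΔ a′ b′) = cong₂ sideΔ (uip a a′) (uip b b′)

InS-irrelevant : ∀ (κ : Vec (Fin m) r) N lam Θ σ c → Irrelevant (InS N κ lam Θ σ c)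
InS-irrelevant κ N lam Θ σ c
  record { nonzero = nz ; top = top ; bottom = bottom ; sides = sides }
  record { nonzero = nz′ ; top = top′ ; bottom = bottom′ ; sides = sides′ }
  with refl ← VecAll.irrelevant (VecAll.irrelevant nonzero-irrelevant) nz nz′
     | refl ← uip top top′
     | refl ← uip bottom bottom′
     | refl ← VecAll.irrelevant (SideBoundary-irrelevant _ _ _) sides sides′ = refl

module _ {m r : ℕ} (N : ℕ) (κ : Vec (Fin m) r) (lam : Vec ℕ r) (Θ : Vec RowType r) (σ : Vec (Fin m) r) where

  private
    T = topBoundary N κ lam

  InS⇔RowsPointwise : ∀ Hs Ls →
    InS N κ lam Θ σ (latticeConfig Hs (mirror T ∷ Ls)) ⇔ RowsPointwise Θ σ Hs (mirror T ∷ Ls)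
  InS⇔RowsPointwise Hs Ls = mk⇔ to from
    where
    Lv = mirror T ∷ Ls
    c  = latticeConfig Hs Lv
    to : InS N κ lam Θ σ c → RowsPointwise Θ σ Hs Lv
    to x = (λ i → admissible i , ends i) , bottom
      where
      admissible : ∀ i → AdmissibleRow (lookup Θ i) (lookup Hs i) (lookup Lv (inject₁ i)) (lookup Lv (suc i))
      admissible i = Equivalence.from (AdmissibleRow⇔lookup (lookup Θ i) _ _ _) λ j →
        subst NonZeroW (vertexWeight-latticeConfig (lookup Θ i) Hs Lv i j)
          (tabulate⁻ (tabulate⁻ (InS.nonzero x) i) (opposite j))
      ends : ∀ i → BoundaryEnds (lookup Θ i) (lookup σ i) (lookup Hs i)
      ends i = Equivalence.to (SideBoundary-mirror _ _ _)
        (subst (SideBoundary _ _) (lookup-map i mirror Hs) (tabulate⁻ (InS.sides x) i))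
      bottom : last Lv ≡ replicate N nothing
      bottom = trans (sym (mirror-involutive (last Lv)))
        (trans (cong mirror (trans (sym (map-last-columns Lv)) (InS.bottom x))) (mirror-replicate N nothing))
    from : RowsPointwise Θ σ Hs Lv → InS N κ lam Θ σ c
    from (pw , last≡) = record
      { nonzero = tabulate⁺ λ i → tabulate⁺ λ k →
          subst (NonZeroW ∘ vertexWeight (lookup Θ i) c i) (opposite-involutive k)
            (subst NonZeroW (sym (vertexWeight-latticeConfig (lookup Θ i) Hs Lv i (opposite k)))
              (Equivalence.to (AdmissibleRow⇔lookup (lookup Θ i) _ _ _) (proj₁ (pw i)) (opposite k)))
      ; top = trans (map-head-columns Lv) (mirror-involutive T)
      ; bottom = trans (map-last-columns Lv) (trans (cong mirror last≡) (mirror-replicate N nothing))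
      ; sides = tabulate⁺ λ i → subst (SideBoundary _ _) (sym (lookup-map i mirror Hs))
          (Equivalence.from (SideBoundary-mirror _ _ _) (proj₂ (pw i)))
      }

  Sσ↔Rows : Sσ N κ lam Θ σ ↔
    (Σ[ Hs ∈ Vec (Vec (Edge m) (suc N)) r ] Σ[ Ls ∈ Vec (Vec (Edge m) N) r ] Rows Θ σ Hs (mirror T ∷ Ls))
  Sσ↔Rows = ↔-trans
    (subset-↔ (InS-irrelevant κ N lam Θ σ) (λ (Hs , Ls) → Rows-irrelevant Θ σ Hs (mirror T ∷ Ls))
      toLattice fromLattice InS⇒Rows Rows⇒InS fromLattice-toLattice (λ {(Hs , Ls)} _ → toLattice-fromLattice Hs Ls))
    Σ-assoc
    where
    toLattice : Config m r N → Vec (Vec (Edge m) (suc N)) r × Vec (Vec (Edge m) N) r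
    toLattice c = map mirror (hor c) , tail (levels (ver c))
    fromLattice : Vec (Vec (Edge m) (suc N)) r × Vec (Vec (Edge m) N) r → Config m r N
    fromLattice (Hs , Ls) = latticeConfig Hs (mirror T ∷ Ls)
    toLattice-fromLattice : ∀ Hs Ls → toLattice (fromLattice (Hs , Ls)) ≡ (Hs , Ls)
    toLattice-fromLattice Hs Ls = cong₂ _,_ (map-mirror-involutive Hs) (cong tail (levels-columns (mirror T ∷ Ls)))
    fromLattice-toLattice : ∀ {c} → InS N κ lam Θ σ c → fromLattice (toLattice c) ≡ c
    fromLattice-toLattice {config hor ver} x = cong₂ config (map-mirror-involutive hor)
      (trans (cong columns top-level) (columns-levels ver))
      where
      top-level : mirror T ∷ tail (levels ver) ≡ levels ver
      top-level = cong (_∷ tail (levels ver)) (trans (cong mirror (sym (InS.top x))) (sym (head-levels ver)))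
    Rows⇒InS : ∀ {(Hs , Ls) : _ × _} → Rows Θ σ Hs (mirror T ∷ Ls) → InS N κ lam Θ σ (fromLattice (Hs , Ls))
    Rows⇒InS = Equivalence.from (InS⇔RowsPointwise _ _) ∘ Equivalence.to (Rows⇔pointwise _ _ _ _)
    InS⇒Rows : ∀ {c} → InS N κ lam Θ σ c →
      Rows Θ σ (proj₁ (toLattice c)) (mirror T ∷ proj₂ (toLattice c))
    InS⇒Rows {c} x = Equivalence.from (Rows⇔pointwise _ _ _ _) (Equivalence.to (InS⇔RowsPointwise _ _)
      (subst (InS N κ lam Θ σ) (sym (fromLattice-toLattice x)) x))

S↔Lattice : ∀ N (κ : Vec (Fin m) r) lam Θ → S N κ lam Θ ↔ Lattice Θ (mirror (topBoundary N κ lam))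
S↔Lattice N κ lam Θ = Σ.congˡ λ {σ} → Sσ↔Rows N κ lam Θ σ

lookup-indicator : ∀ N xs (j : Fin N) → lookup (indicator N xs) j ≡ (N ∸ suc (toℕ j)) ∈ᵇ xs
lookup-indicator (suc N) xs zero    = refl
lookup-indicator (suc N) xs (suc j) = lookup-indicator N xs j

is-just-topColour : ∀ k (ν : Vec ℕ n) (κ : Vec (Fin m) n) → is-just (topColour k ν κ) ≡ k ∈ᵇ toList ν
is-just-topColour k []       []       = refl
is-just-topColour k (p ∷ ν) (c ∷ κ) with k ≡ᵇ p
... | true  = refl
... | false = is-just-topColour k ν κ

occupancy-top : ∀ N (κ : Vec (Fin m) r) lam →
  occupancy (mirror (topBoundary N κ lam)) ≡ indicator N (toList (lamRho lam))
occupancy-top N κ lam = lookup-extensionality λ j → begin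
  lookup (occupancy (mirror T)) j                        ≡⟨ lookup-map j is-just (mirror T) ⟩
  is-just (lookup (mirror T) j)                          ≡⟨ cong is-just (lookup-mirror T j) ⟩
  is-just (lookup T (opposite j))                        ≡⟨ cong is-just (lookup∘tabulate _ (opposite j)) ⟩
  is-just (topColour (toℕ (opposite j)) (lamRho lam) κ)  ≡⟨ is-just-topColour _ (lamRho lam) κ ⟩
  toℕ (opposite j) ∈ᵇ toList (lamRho lam)               ≡⟨ cong (_∈ᵇ toList (lamRho lam)) (opposite-prop j) ⟩
  (N ∸ suc (toℕ j)) ∈ᵇ toList (lamRho lam)              ≡⟨ lookup-indicator N _ j ⟨
  lookup (indicator N (toList (lamRho lam))) j           ∎
  where
  open ≡-Reasoning
  T = topBoundary N κ lam

IsPartition-tail : ∀ {l} {lam : Vec ℕ r} → IsPartition (l ∷ lam) → IsPartition lam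
IsPartition-tail part i j i≤j = part (suc i) (suc j) (s≤s i≤j)

IsPartition-λ₁ : ∀ {l} (lam : Vec ℕ r) → IsPartition (l ∷ lam) → λ₁ lam ≤ l
IsPartition-λ₁ []      _    = z≤n
IsPartition-λ₁ (_ ∷ _) part = part zero (suc zero) z≤n

lamRho-decreasing-< : ∀ (lam : Vec ℕ r) → IsPartition lam →
  Linked _>_ (toList (lamRho lam)) × All (_< λ₁ lam + r) (toList (lamRho lam))
lamRho-decreasing-< []               _    = [] , []
lamRho-decreasing-< {suc r} (l ∷ lam) part =
  Linked-∷ below-l+r (proj₁ IH) , l+r<l+1+r ∷ All.map (λ x< → ≤-trans x< (<⇒≤ l+r<l+1+r)) below-l+r
  where
  IH = lamRho-decreasing-< lam (IsPartition-tail part)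
  below-l+r : All (_< l + r) (toList (lamRho lam))
  below-l+r = All.map (λ x< → <-≤-trans x< (+-monoˡ-≤ r (IsPartition-λ₁ lam part))) (proj₂ IH)
  l+r<l+1+r = +-monoʳ-< l (n<1+n r)

positions-top : ∀ N (κ : Vec (Fin m) r) lam → IsPartition lam → λ₁ lam + r ≤ N →
  positions (occupancy (mirror (topBoundary N κ lam))) ≡ toList (lamRho lam)
positions-top N κ lam part λ₁+r≤N
  with decreasing , bounded ← lamRho-decreasing-< lam part
  = trans (cong positions (occupancy-top N κ lam))
      (positions-indicator N decreasing (All.map (λ x< → <-≤-trans x< λ₁+r≤N) bounded))

proposition4p1 : ∀ {m r : ℕ} (κ : Vec (Fin m) r) (N : ℕ) (lam : Vec ℕ r) →
    IsPartition lam → λ₁ lam + r ≤ N → (Θ : Vec RowType r) →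
    S N κ lam Θ ⤖ GTPΘ Θ (lamRho lam)
proposition4p1 κ N lam part λ₁+r≤N Θ = ↔⇒⤖ (↔-trans
  (S↔Lattice N κ lam Θ)
  (Lattice↔GTPΘ Θ _ (lamRho lam) (positions-top N κ lam part λ₁+r≤N)))
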